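{- For $n\ge0$, the number of Motzkin paths of length $2n+1$ with exactly $n$ ascents is $\binom{n+2}{2}$.
   Context: A Motzkin path of length $N$ is a sequence of $N$ steps $U$ ($+1$), $F$ ($0$), $D$ ($-1$) starting and ending at height $0$ and never going below $0$. An ascent is a maximal run of consecutive $U$ steps. -}

module Defs where

open import Data.Nat using (ℕ; zero; suc; _+_; _≡ᵇ_)
open import Data.Bool using (Bool; true; false; _∧_; if_then_else_)
open import Data.List using (List; []; _∷_; concatMap; map; filter; length)
open import Data.Vec using (Vec; []; _∷_; toList)
open import Data.Maybe using (Maybe; just; nothing; _>>=_)
open import Relation.Nullary.Decidable using (does)
open import Data.Bool.Properties using () renaming (_≟_ to _≟ᵇ_)
open import Relation.Binary.PropositionalEquality using (_≡_)
open import Relation.Unary using (Decidable)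
open import Relation.Nullary using (Dec; yes; no)

-- Steps of a Motzkin path: U (+1), F (0), D (-1).
data Step : Set where
  U F D : Step

allWords : (N : ℕ) → List (Vec Step N)
allWords zero = [] ∷ []
allWords (suc N) = concatMap (λ w → (U ∷ w) ∷ (F ∷ w) ∷ (D ∷ w) ∷ []) (allWords N)

walk : ℕ → List Step → Maybe ℕ
walk h [] = just h
walk h (U ∷ s) = walk (suc h) s
walk h (F ∷ s) = walk h s
walk zero (D ∷ s) = nothing
walk (suc h) (D ∷ s) = walk h s

isMotzkin : {N : ℕ} → Vec Step N → Bool
isMotzkin w with walk 0 (toList w)
... | just 0 = true
... | _ = false

-- Number of ascents = number of maximal runs of consecutive U steps,
-- i.e. the number of positions holding U that are not immediately preceded by U.
ascentsFrom : Bool → List Step → ℕ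
ascentsFrom _ [] = 0
ascentsFrom false (U ∷ s) = suc (ascentsFrom true s)
ascentsFrom true (U ∷ s) = ascentsFrom true s
ascentsFrom _ (F ∷ s) = ascentsFrom false s
ascentsFrom _ (D ∷ s) = ascentsFrom false s

ascents : {N : ℕ} → Vec Step N → ℕ
ascents w = ascentsFrom false (toList w)

motzkinWithAscents : (k : ℕ) {N : ℕ} → Vec Step N → Bool
motzkinWithAscents k w = isMotzkin w ∧ (ascents w ≡ᵇ k)

countMotzkinAscents : ℕ → ℕ → ℕ
countMotzkinAscents N k =
  length (filter (λ w → motzkinWithAscents k w ≟ᵇ true) (allWords N))

module Submission where

-- Generalise the count to words read from an arbitrary start:
-- walks N h b k is the number of step words of length N which, started at
-- height h with "the previous step was U" flag b, stay non-negative, end at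
-- height 0 and open exactly k new ascents.  Each new ascent costs
-- a U step and a matching D step and each unit of height a D step, so no such
-- word is shorter than minLength k h = 2k + h (walks-short).  Near that length
-- a U step must be followed by a D step, so minimal walks satisfy Pascal's
-- recursion and number (k + h) C h (walks-minimal).  A Motzkin path of length
-- 2n + 1 with n ascents is one step longer than minimal: it starts with U
-- (after which two minimal cases remain) or with F (after which it is
-- minimal), so c(n+1) = (n+1) + c(n) + 1 and c(n) = (n+2) C 2
-- (walks-one-above-minimal).  proposition8 just chains these facts.

open import Defs
open import Data.Nat using (ℕ; zero; suc; _+_; _*_; _<_; _≡ᵇ_; s<s⁻¹)
open import Data.Nat.Properties
  using (+-suc; +-comm; +-identityʳ; <-trans; n<1+n; +-monoʳ-<)
open import Data.Nat.Combinatorics using (_C_; nCn≡1; nC1≡n; nCk+nC[k+1]≡[n+1]C[k+1])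
open import Data.Nat.Tactic.RingSolver using (solve-∀)
open import Data.Bool using (Bool; true; false; _∧_)
open import Data.Bool.Properties using (∧-zeroʳ) renaming (_≟_ to _≟ᵇ_)
open import Data.List using (List; []; _∷_; filter; length; concatMap)
open import Data.Vec using (Vec; toList) renaming (_∷_ to _∷ᵥ_)
open import Data.Maybe using (Maybe; just; nothing)
open import Relation.Binary.PropositionalEquality
  using (_≡_; refl; sym; trans; cong; cong₂; subst; module ≡-Reasoning)

open ≡-Reasoning

indicator : Bool → ℕ
indicator true  = 1
indicator false = 0

count : {A : Set} → (A → Bool) → List A → ℕ
count P []       = 0
count P (x ∷ xs) = indicator (P x) + count P xs

length-filter : {A : Set} (P : A → Bool) (xs : List A) →
                length (filter (λ x → P x ≟ᵇ true) xs) ≡ count P xs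
length-filter P []       = refl
length-filter P (x ∷ xs) with P x
... | true  = cong suc (length-filter P xs)
... | false = length-filter P xs

count-cong : {A : Set} {P Q : A → Bool} → (∀ x → P x ≡ Q x) →
             (xs : List A) → count P xs ≡ count Q xs
count-cong P≗Q []       = refl
count-cong P≗Q (x ∷ xs) = cong₂ _+_ (cong indicator (P≗Q x)) (count-cong P≗Q xs)

count-never : {A : Set} {P : A → Bool} → (∀ x → P x ≡ false) →
              (xs : List A) → count P xs ≡ 0
count-never never []       = refl
count-never never (x ∷ xs) = cong₂ _+_ (cong indicator (never x)) (count-never never xs)

extensions : {N : ℕ} → Vec Step N → List (Vec Step (suc N))
extensions w = (U ∷ᵥ w) ∷ (F ∷ᵥ w) ∷ (D ∷ᵥ w) ∷ []

count-extensions : {N : ℕ} (P : Vec Step (suc N) → Bool) (ws : List (Vec Step N)) →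
  count P (concatMap extensions ws)
  ≡ count (λ w → P (U ∷ᵥ w)) ws + count (λ w → P (F ∷ᵥ w)) ws + count (λ w → P (D ∷ᵥ w)) ws
count-extensions P []       = refl
count-extensions P (w ∷ ws) = begin
    u + (f + (d + count P (concatMap extensions ws)))
  ≡⟨ cong (λ r → u + (f + (d + r))) (count-extensions P ws) ⟩
    u + (f + (d + (cU + cF + cD)))
  ≡⟨ interchange u f d cU cF cD ⟩
    (u + cU) + (f + cF) + (d + cD)
  ∎
  where
    u f d cU cF cD : ℕ
    u  = indicator (P (U ∷ᵥ w))
    f  = indicator (P (F ∷ᵥ w))
    d  = indicator (P (D ∷ᵥ w))
    cU = count (λ v → P (U ∷ᵥ v)) ws
    cF = count (λ v → P (F ∷ᵥ v)) ws
    cD = count (λ v → P (D ∷ᵥ v)) ws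

    interchange : ∀ a b c x y z → a + (b + (c + (x + y + z))) ≡ (a + x) + (b + y) + (c + z)
    interchange = solve-∀

endsAtGround : Maybe ℕ → Bool
endsAtGround (just zero) = true
endsAtGround _           = false

returnsWith : ℕ → Bool → ℕ → {N : ℕ} → Vec Step N → Bool
returnsWith h b k w = endsAtGround (walk h (toList w)) ∧ (ascentsFrom b (toList w) ≡ᵇ k)

mutual
  walks : ℕ → ℕ → Bool → ℕ → ℕ
  walks zero    zero    _ zero    = 1
  walks zero    zero    _ (suc k) = 0
  walks zero    (suc h) _ k       = 0
  walks (suc N) h       b k       = afterUp N h b k + walks N h false k + afterDown N h k

  -- Words starting with U: the step opens a new ascent unless the flag is set.
  afterUp : ℕ → ℕ → Bool → ℕ → ℕ
  afterUp N h false zero    = 0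
  afterUp N h false (suc k) = walks N (suc h) true k
  afterUp N h true  k       = walks N (suc h) true k

  afterDown : ℕ → ℕ → ℕ → ℕ
  afterDown N zero    k = 0
  afterDown N (suc h) k = walks N h false k

walks-count : ∀ N h b k → count (returnsWith h b k) (allWords N) ≡ walks N h b k
walks-count zero    zero    b zero    = refl
walks-count zero    zero    b (suc k) = refl
walks-count zero    (suc h) b k       = refl
walks-count (suc N) h       b k       =
  trans (count-extensions (returnsWith h b k) (allWords N))
        (cong₂ _+_ (cong₂ _+_ (firstUp b k) (firstFlat b)) (firstDown b h))
  where
    firstUp : ∀ b k → count (λ w → returnsWith h b k (U ∷ᵥ w)) (allWords N) ≡ afterUp N h b k
    firstUp false zero    = count-never (λ w → ∧-zeroʳ _) (allWords N)
    firstUp false (suc k) = walks-count N (suc h) true k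
    firstUp true  k       = walks-count N (suc h) true k

    firstFlat : ∀ b → count (λ w → returnsWith h b k (F ∷ᵥ w)) (allWords N) ≡ walks N h false k
    firstFlat false = walks-count N h false k
    firstFlat true  = walks-count N h false k

    firstDown : ∀ b h → count (λ w → returnsWith h b k (D ∷ᵥ w)) (allWords N) ≡ afterDown N h k
    firstDown b     zero    = count-never (λ w → refl) (allWords N)
    firstDown false (suc h) = walks-count N h false k
    firstDown true  (suc h) = walks-count N h false k

isMotzkin-endsAtGround : {N : ℕ} (w : Vec Step N) → isMotzkin w ≡ endsAtGround (walk 0 (toList w))
isMotzkin-endsAtGround w with walk 0 (toList w)
... | just zero    = refl
... | just (suc _) = refl
... | nothing      = refl

motzkin-walks : ∀ N k → countMotzkinAscents N k ≡ walks N 0 false k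
motzkin-walks N k = begin
    countMotzkinAscents N k
  ≡⟨ length-filter (motzkinWithAscents k) (allWords N) ⟩
    count (motzkinWithAscents k) (allWords N)
  ≡⟨ count-cong (λ w → cong (_∧ (ascents w ≡ᵇ k)) (isMotzkin-endsAtGround w)) (allWords N) ⟩
    count (returnsWith 0 false k) (allWords N)
  ≡⟨ walks-count N 0 false k ⟩
    walks N 0 false k
  ∎

minLength : ℕ → ℕ → ℕ
minLength k h = 2 * k + h

-- An ascent costs one U step plus one more unit of height to come down from.
minLength-ascent : ∀ k h → minLength (suc k) h ≡ suc (minLength k (suc h))
minLength-ascent k h =
  cong suc (trans (cong (_+ h) (+-suc k (k + 0))) (sym (+-suc (2 * k) h)))

-- Each unit of height costs one D step.
minLength-height : ∀ k h → minLength k (suc h) ≡ suc (minLength k h)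
minLength-height k h = +-suc (2 * k) h

minLength-grows : ∀ k h → minLength k h < minLength k (suc h)
minLength-grows k h = +-monoʳ-< (2 * k) (n<1+n h)

walks-short : ∀ N h b k → N < minLength k h → walks N h b k ≡ 0
walks-short zero    zero    b zero    ()
walks-short zero    zero    b (suc k) _ = refl
walks-short zero    (suc h) b k       _ = refl
walks-short (suc N) h       b k       N+1<min =
  cong₂ _+_ (cong₂ _+_ (up b k N+1<min) (walks-short N h false k (<-trans (n<1+n N) N+1<min)))
            (down h N+1<min)
  where
    up : ∀ b k → suc N < minLength k h → afterUp N h b k ≡ 0
    up false zero    _  = refl
    up false (suc k) lt = walks-short N (suc h) true k (s<s⁻¹ (subst (suc N <_) (minLength-ascent k h) lt))
    up true  k       lt = walks-short N (suc h) true k (<-trans (<-trans (n<1+n N) lt) (minLength-grows k h))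

    down : ∀ h → suc N < minLength k h → afterDown N h k ≡ 0
    down zero    _  = refl
    down (suc h) lt = walks-short N h false k (s<s⁻¹ (subst (suc N <_) (minLength-height k h) lt))

-- Close to the minimal length, a U step cannot be followed by another U step.
walks-after-up : ∀ M h k → M < minLength k (suc (suc h)) →
                 walks (suc M) (suc h) true k ≡ walks M (suc h) false k + walks M h false k
walks-after-up M h k M<min =
  cong (λ x → x + walks M (suc h) false k + walks M h false k) (walks-short M (suc (suc h)) true k M<min)

-- A minimal walk with k + 1 ascents starts with UD (followed by a minimal walk
-- with k ascents) or with D; it cannot start with F.
minimal-split : ∀ k h → walks (minLength (suc k) h) h false (suc k)
                        ≡ walks (minLength k h) h false k + afterDown (minLength k (suc h)) h (suc k)
minimal-split k h = begin
    walks (minLength (suc k) h) h false (suc k)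
  ≡⟨ cong (λ N → walks N h false (suc k)) (minLength-ascent k h) ⟩
    walks M (suc h) true k + walks M h false (suc k) + afterDown M h (suc k)
  ≡⟨ cong₂ (λ x y → x + y + afterDown M h (suc k)) upThenDown noFlat ⟩
    walks (minLength k h) h false k + 0 + afterDown M h (suc k)
  ≡⟨ cong (_+ afterDown M h (suc k)) (+-identityʳ _) ⟩
    walks (minLength k h) h false k + afterDown M h (suc k)
  ∎
  where
    M : ℕ
    M = minLength k (suc h)

    upThenDown : walks M (suc h) true k ≡ walks (minLength k h) h false k
    upThenDown = begin
        walks M (suc h) true k
      ≡⟨ cong (λ N → walks N (suc h) true k) (minLength-height k h) ⟩
        walks (suc (minLength k h)) (suc h) true k
      ≡⟨ walks-after-up (minLength k h) h k (<-trans (minLength-grows k h) (minLength-grows k (suc h))) ⟩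
        walks (minLength k h) (suc h) false k + walks (minLength k h) h false k
      ≡⟨ cong (_+ walks (minLength k h) h false k) (walks-short _ (suc h) false k (minLength-grows k h)) ⟩
        walks (minLength k h) h false k
      ∎

    noFlat : walks M h false (suc k) ≡ 0
    noFlat = walks-short M h false (suc k) (subst (M <_) (sym (minLength-ascent k h)) (n<1+n M))

-- Minimal walks are counted by a binomial coefficient (they are the shuffles
-- of k blocks UD with h blocks D).
walks-minimal : ∀ k h → walks (minLength k h) h false k ≡ (k + h) C h
walks-minimal zero    zero    = refl
walks-minimal zero    (suc h) = begin
    walks h (suc h) false 0 + walks h h false 0
  ≡⟨ cong₂ _+_ (walks-short h (suc h) false 0 (n<1+n h)) (walks-minimal zero h) ⟩
    h C h
  ≡⟨ trans (nCn≡1 h) (sym (nCn≡1 (suc h))) ⟩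
    suc h C suc h
  ∎
walks-minimal (suc k) zero    = trans (minimal-split k 0) (cong (_+ 0) (walks-minimal k 0))
walks-minimal (suc k) (suc h) = begin
    walks (minLength (suc k) (suc h)) (suc h) false (suc k)
  ≡⟨ minimal-split k (suc h) ⟩
    walks (minLength k (suc h)) (suc h) false k + walks (minLength k (suc (suc h))) h false (suc k)
  ≡⟨ cong (walks (minLength k (suc h)) (suc h) false k +_)
          (cong (λ N → walks N h false (suc k)) (trans (minLength-height k (suc h)) (sym (minLength-ascent k h)))) ⟩
    walks (minLength k (suc h)) (suc h) false k + walks (minLength (suc k) h) h false (suc k)
  ≡⟨ cong₂ _+_ (walks-minimal k (suc h)) (walks-minimal (suc k) h) ⟩
    (k + suc h) C suc h + suc (k + h) C h
  ≡⟨ cong (λ n → (k + suc h) C suc h + n C h) (sym (+-suc k h)) ⟩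
    (k + suc h) C suc h + (k + suc h) C h
  ≡⟨ +-comm ((k + suc h) C suc h) _ ⟩
    (k + suc h) C h + (k + suc h) C suc h
  ≡⟨ nCk+nC[k+1]≡[n+1]C[k+1] (k + suc h) h ⟩
    suc (k + suc h) C suc h
  ∎

-- Paths from the ground one step longer than minimal: the first step is U
-- (then, by walks-after-up, the rest is minimal from height 1 or one step
-- longer than minimal from the ground) or F (then the rest is minimal).
walks-one-above-minimal : ∀ n → walks (suc (minLength n 0)) 0 false n ≡ (n + 2) C 2
walks-one-above-minimal zero    = refl
walks-one-above-minimal (suc n) = begin
    walks (suc (minLength (suc n) 0)) 0 false (suc n)
  ≡⟨ cong (λ N → walks (suc N) 0 false (suc n)) (minLength-ascent n 0) ⟩
    walks (suc M) 1 true n + walks (suc M) 0 false (suc n) + 0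
  ≡⟨ cong₂ (λ x y → x + y + 0) (walks-after-up M 0 n (minLength-grows n 1)) flatThenMinimal ⟩
    walks M 1 false n + walks M 0 false n + 1 + 0
  ≡⟨ cong₂ (λ x y → x + y + 1 + 0) (walks-minimal n 1) previous ⟩
    (n + 1) C 1 + (n + 2) C 2 + 1 + 0
  ≡⟨ cong (λ x → x + (n + 2) C 2 + 1 + 0) (nC1≡n (n + 1)) ⟩
    n + 1 + (n + 2) C 2 + 1 + 0
  ≡⟨ regroup n ((n + 2) C 2) ⟩
    (n + 2) + (n + 2) C 2
  ≡⟨ cong (_+ (n + 2) C 2) (sym (nC1≡n (n + 2))) ⟩
    (n + 2) C 1 + (n + 2) C 2
  ≡⟨ nCk+nC[k+1]≡[n+1]C[k+1] (n + 2) 1 ⟩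
    suc (n + 2) C 2
  ∎
  where
    M : ℕ
    M = minLength n 1

    flatThenMinimal : walks (suc M) 0 false (suc n) ≡ 1
    flatThenMinimal = trans (cong (λ N → walks N 0 false (suc n)) (sym (minLength-ascent n 0)))
                            (walks-minimal (suc n) 0)

    previous : walks M 0 false n ≡ (n + 2) C 2
    previous = trans (cong (λ N → walks N 0 false n) (minLength-height n 0)) (walks-one-above-minimal n)

    regroup : ∀ n c → n + 1 + c + 1 + 0 ≡ (n + 2) + c
    regroup = solve-∀

-- A Motzkin path of length 2n + 1 = minLength n 1 with n ascents is one step
-- longer than the minimum for n ascents.
proposition8 : (n : ℕ) → countMotzkinAscents (2 * n + 1) n ≡ (n + 2) C 2
proposition8 n = begin
    countMotzkinAscents (2 * n + 1) n
  ≡⟨ motzkin-walks (2 * n + 1) n ⟩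
    walks (minLength n 1) 0 false n
  ≡⟨ cong (λ N → walks N 0 false n) (minLength-height n 0) ⟩
    walks (suc (minLength n 0)) 0 false n
  ≡⟨ walks-one-above-minimal n ⟩
    (n + 2) C 2
  ∎
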